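{- For every even $n\ge 4$, the $(1,3)$-biased Clique game on $K_n$ is won by player $2$.
   Context: Two players, Alice (player 1, starting) and Bob (player 2), alternately colour uncoloured edges of the complete graph $K_n$, Alice in red and Bob in blue. In the $(p,q)$-biased version Alice colours $p$ edges on each of her turns and Bob colours $q$ edges on each of his turns. In the Clique game, at the end Alice's score is $a=\omega(G[A])$ and Bob's score is $b=\omega(G[B])$, the clique numbers of the graphs formed by the red edges $A$ and the blue edges $B$. When $q>p$, Bob (player 2) wins if at the end $b>a$. Here $(p,q)=(1,3)$. -}

module Defs where

open import Data.Nat using (ℕ; _<_)
open import Data.Fin using (Fin)
import Data.Fin as F
open import Data.Product using (Σ; _×_; _,_; proj₁; proj₂; ∃)
open import Data.Sum using (_⊎_)
open import Data.List using (List; []; _∷_; _++_; length)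
open import Data.List.Membership.Propositional using (_∈_; _∉_)
open import Data.List.Relation.Unary.All using (All)
open import Data.List.Relation.Unary.Unique.Propositional using (Unique)
open import Data.List.Relation.Unary.Any using (Any)
open import Relation.Binary.PropositionalEquality using (_≡_; _≢_)
open import Relation.Nullary using (¬_)
open import Function.Definitions using (Injective)

-- An edge of K_n: an unordered pair {i , j} of distinct vertices, stored as i < j.
Edge : ℕ → Set
Edge n = Σ (Fin n × Fin n) (λ p → proj₁ p F.< proj₂ p)

src tgt : ∀ {n} → Edge n → Fin n
src e = proj₁ (proj₁ e)
tgt e = proj₂ (proj₁ e)

Adj : ∀ {n} → List (Edge n) → Fin n → Fin n → Set
Adj E u v = Any (λ e → (src e ≡ u × tgt e ≡ v) ⊎ (src e ≡ v × tgt e ≡ u)) E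

HasClique : ∀ {n} → List (Edge n) → ℕ → Set
HasClique {n} E k =
  Σ (Fin k → Fin n) λ f → Injective _≡_ _≡_ f × (∀ i j → i ≢ j → Adj E (f i) (f j))

IsCliqueNumber : ∀ {n} → List (Edge n) → ℕ → Set
IsCliqueNumber E ω = HasClique E ω × (∀ k → HasClique E k → k ≤' ω)
  where
  open import Data.Nat using () renaming (_≤_ to _≤'_)

Complete : ∀ {n} → List (Edge n) → List (Edge n) → Set
Complete {n} red blue = ∀ (e : Edge n) → e ∈ red ⊎ e ∈ blue

Uncoloured : ∀ {n} → List (Edge n) → List (Edge n) → Edge n → Set
Uncoloured red blue e = e ∉ red × e ∉ blue

BobScoreWins : ∀ {n} → List (Edge n) → List (Edge n) → Set
BobScoreWins red blue =
  ∀ a b → IsCliqueNumber red a → IsCliqueNumber blue b → a < b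

data BobWinsAliceToMove {n : ℕ} (red blue : List (Edge n)) : Set
data BobWinsBobToMove {n : ℕ} (red blue : List (Edge n)) : Set

data BobWinsAliceToMove {n} red blue where
  finished : Complete red blue → BobScoreWins red blue →
             BobWinsAliceToMove red blue
  move     : ¬ Complete red blue →
             (∀ e → Uncoloured red blue e → BobWinsBobToMove (e ∷ red) blue) →
             BobWinsAliceToMove red blue

data BobWinsBobToMove {n} red blue where
  finished : Complete red blue → BobScoreWins red blue →
             BobWinsBobToMove red blue
  move     : ¬ Complete red blue →
             (es : List (Edge n)) → Unique es → All (Uncoloured red blue) es →
             (length es ≡ 3 ⊎ (length es < 3 × Complete red (es ++ blue))) →
             BobWinsAliceToMove red (es ++ blue) →
             BobWinsBobToMove red blue

module Submission where

-- Bob pairs the vertices by a perfect matching σ and, after Alice's first edge, fixes a hub pair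
-- {h , σ h}. He keeps h σ h blue and answers every red edge uv by colouring at most three of its
-- mirror edges blue: u σv, σu v and σu σv for a generic edge, h σv and σh σv (and v σv if u = h)
-- for an edge leaving the hub, and h u, h σu for a matching edge u σu.
-- In the final colouring a red clique K containing a matching edge has at most two vertices, while
-- blue contains a triangle through h and σ h. Otherwise σ(K) is a blue clique, which extends by a
-- hub vertex of K, a vertex of K whose matching edge is blue, or h. So ω(blue) > ω(red).

open import Defs
open import Data.Nat as ℕ using (ℕ; zero; suc; _+_; _≤_; _<_; _*_; s≤s; z≤n)
import Data.Nat.Properties as ℕP
open import Data.Nat.Divisibility using (_∣_; divides)
open import Data.Fin as F using (Fin; zero; suc)
import Data.Fin.Properties as FP
open import Data.Product using (Σ; _×_; _,_; proj₁; proj₂)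
open import Data.Sum using (_⊎_; inj₁; inj₂; [_,_])
open import Data.Empty using (⊥; ⊥-elim)
open import Data.List using (List; []; _∷_; _++_; length; filter; take; deduplicate; cartesianProduct; allFin)
import Data.List.Properties as LP
open import Data.List.Membership.Propositional using (_∈_; _∉_)
open import Data.List.Membership.Propositional.Properties
  using (∈-filter⁺; ∈-filter⁻; ∈-allFin; ∈-cartesianProduct⁺; ∈-deduplicate⁺; ∈-deduplicate⁻;
         ∈-++⁺ˡ; ∈-++⁺ʳ; ∈-++⁻)
import Data.List.Membership.DecPropositional as DecMembership
open import Data.List.Relation.Unary.Any as Any using (Any; here; there)
import Data.List.Relation.Unary.Any.Properties as AnyP
open import Data.List.Relation.Unary.All as All using (All; _∷_)
open import Data.List.Relation.Unary.Unique.Propositional using (Unique)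
open import Data.List.Relation.Binary.Subset.Propositional using (_⊆_)
import Data.List.Relation.Unary.Unique.DecPropositional.Properties as UniqueP
open import Function using (_∘_)
open import Relation.Binary using (DecidableEquality; tri<; tri≈; tri>)
open import Relation.Binary.PropositionalEquality hiding ([_])
open import Relation.Nullary using (¬_; Dec; yes; no)
open import Relation.Nullary.Decidable using (¬?; _×-dec_; _⊎-dec_; decidable-stable)
open import Relation.Unary using (Pred; Decidable)
open import Level using (0ℓ)

-- A perfect matching of the vertices

data Even : ℕ → Set where
  even-zero : Even 0
  even-suc  : ∀ {n} → Even n → Even (suc (suc n))

even-*2 : ∀ q → Even (q * 2)
even-*2 zero    = even-zero
even-*2 (suc q) = even-suc (even-*2 q)

-- σ matches 2i with 2i+1; for odd n it fixes the last vertex.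
σ : ∀ {n} → Fin n → Fin n
σ {suc zero}    zero          = zero
σ {suc (suc n)} zero          = suc zero
σ {suc (suc n)} (suc zero)    = zero
σ {suc (suc n)} (suc (suc i)) = suc (suc (σ i))

σ-involutive : ∀ {n} (i : Fin n) → σ (σ i) ≡ i
σ-involutive {suc zero}    zero          = refl
σ-involutive {suc (suc n)} zero          = refl
σ-involutive {suc (suc n)} (suc zero)    = refl
σ-involutive {suc (suc n)} (suc (suc i)) = cong (λ j → suc (suc j)) (σ-involutive i)

σ-injective : ∀ {n} {i j : Fin n} → σ i ≡ σ j → i ≡ j
σ-injective {i = i} {j} eq = trans (sym (σ-involutive i)) (trans (cong σ eq) (σ-involutive j))

≢σ-sym : ∀ {n} {u v : Fin n} → u ≢ σ v → v ≢ σ u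
≢σ-sym {u = u} u≢σv v≡σu = u≢σv (trans (sym (σ-involutive u)) (cong σ (sym v≡σu)))

σ-fixpoint-free : ∀ {n} → Even n → (i : Fin n) → σ i ≢ i
σ-fixpoint-free (even-suc ev) zero          ()
σ-fixpoint-free (even-suc ev) (suc zero)    ()
σ-fixpoint-free (even-suc ev) (suc (suc i)) eq =
  σ-fixpoint-free ev i (FP.suc-injective (FP.suc-injective eq))

-- Edges and cliques

Joins : ∀ {n} → Edge n → Fin n → Fin n → Set
Joins e u v = (src e ≡ u × tgt e ≡ v) ⊎ (src e ≡ v × tgt e ≡ u)

Ends : ∀ {n} → Edge n → Fin n → Fin n → Set
Ends e w x = ∀ {u v} → Joins e u v → (u ≡ w × v ≡ x) ⊎ (u ≡ x × v ≡ w)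

edge-≡ : ∀ {n} {e e' : Edge n} → src e ≡ src e' → tgt e ≡ tgt e' → e ≡ e'
edge-≡ {e = (a , b) , p} {(.a , .b) , p'} refl refl = cong ((a , b) ,_) (ℕP.<-irrelevant p p')

_≟ᴱ_ : ∀ {n} → DecidableEquality (Edge n)
e ≟ᴱ e' with src e FP.≟ src e' | tgt e FP.≟ tgt e'
... | yes s≡s' | yes t≡t' = yes (edge-≡ s≡s' t≡t')
... | no s≢s'  | _        = no λ { refl → s≢s' refl }
... | yes _    | no t≢t'  = no λ { refl → t≢t' refl }

joins-ends : ∀ {n} (e : Edge n) → Joins e (src e) (tgt e)
joins-ends e = inj₁ (refl , refl)

ends : ∀ {n} (e : Edge n) → Ends e (src e) (tgt e)
ends e (inj₁ (s≡u , t≡v)) = inj₁ (sym s≡u , sym t≡v)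
ends e (inj₂ (s≡v , t≡u)) = inj₂ (sym t≡u , sym s≡v)

Ends-swap : ∀ {n} {e : Edge n} {w x} → Ends e w x → Ends e x w
Ends-swap ends-e j with ends-e j
... | inj₁ p = inj₂ p
... | inj₂ p = inj₁ p

Ends-¬Joinsˡ : ∀ {n} {e : Edge n} {p q u v} → Ends e p q → u ≢ p → u ≢ q → ¬ Joins e u v
Ends-¬Joinsˡ ends-e u≢p u≢q j with ends-e j
... | inj₁ (u≡p , _) = u≢p u≡p
... | inj₂ (u≡q , _) = u≢q u≡q

Ends-¬Joinsʳ : ∀ {n} {e : Edge n} {p q u v} → Ends e p q → v ≢ p → v ≢ q → ¬ Joins e u v
Ends-¬Joinsʳ ends-e v≢p v≢q j with ends-e j
... | inj₁ (_ , v≡q) = v≢q v≡q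
... | inj₂ (_ , v≡p) = v≢p v≡p

Joins-sym : ∀ {n} {e : Edge n} {u v} → Joins e u v → Joins e v u
Joins-sym (inj₁ p) = inj₂ p
Joins-sym (inj₂ p) = inj₁ p

Joins-irrefl : ∀ {n} {e : Edge n} {u} → ¬ Joins e u u
Joins-irrefl {e = e} (inj₁ (a , b)) = FP.<-irrefl (trans a (sym b)) (proj₂ e)
Joins-irrefl {e = e} (inj₂ (a , b)) = FP.<-irrefl (trans a (sym b)) (proj₂ e)

Joins-unique : ∀ {n} {e e' : Edge n} {u v} → Joins e u v → Joins e' u v → e ≡ e'
Joins-unique (inj₁ (a , b)) (inj₁ (c , d)) = edge-≡ (trans a (sym c)) (trans b (sym d))
Joins-unique (inj₂ (a , b)) (inj₂ (c , d)) = edge-≡ (trans a (sym c)) (trans b (sym d))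
Joins-unique {e = e} {e'} (inj₁ (a , b)) (inj₂ (c , d)) =
  ⊥-elim (FP.<-asym (proj₂ e) (subst₂ F._<_ (trans c (sym b)) (trans d (sym a)) (proj₂ e')))
Joins-unique {e = e} {e'} (inj₂ (a , b)) (inj₁ (c , d)) =
  ⊥-elim (FP.<-asym (proj₂ e) (subst₂ F._<_ (trans c (sym b)) (trans d (sym a)) (proj₂ e')))

Joins? : ∀ {n} (e : Edge n) u v → Dec (Joins e u v)
Joins? e u v = ((src e FP.≟ u) ×-dec (tgt e FP.≟ v)) ⊎-dec ((src e FP.≟ v) ×-dec (tgt e FP.≟ u))

edgeJoining : ∀ {n} (u v : Fin n) → u ≢ v → Σ (Edge n) λ e → Joins e u v
edgeJoining u v u≢v with FP.<-cmp u v
... | tri< u<v _ _ = ((u , v) , u<v) , inj₁ (refl , refl)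
... | tri≈ _ u≡v _ = ⊥-elim (u≢v u≡v)
... | tri> _ _ v<u = ((v , u) , v<u) , inj₂ (refl , refl)

Adj⇒∈ : ∀ {n} {E : List (Edge n)} {e u v} → Joins e u v → Adj E u v → e ∈ E
Adj⇒∈ {u = u} {v} j (here j') = here (Joins-unique {u = u} {v} j j')
Adj⇒∈ j (there a) = there (Adj⇒∈ j a)

∈⇒Adj : ∀ {n} {E : List (Edge n)} {e u v} → Joins e u v → e ∈ E → Adj E u v
∈⇒Adj j (here refl) = here j
∈⇒Adj j (there m)   = there (∈⇒Adj j m)

Adj-sym : ∀ {n} {E : List (Edge n)} {u v} → Adj E u v → Adj E v u
Adj-sym = Any.map (λ {e} → Joins-sym {e = e})

Adj-irrefl : ∀ {n} {E : List (Edge n)} {u} → ¬ Adj E u u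
Adj-irrefl {E = e ∷ _} (here j) = Joins-irrefl {e = e} j
Adj-irrefl (there a) = Adj-irrefl a

Adj? : ∀ {n} (E : List (Edge n)) u v → Dec (Adj E u v)
Adj? E u v = Any.any? (λ e → Joins? e u v) E

Complete⇒Adj : ∀ {n} {R B : List (Edge n)} → Complete R B → ∀ {u v} → u ≢ v → Adj R u v ⊎ Adj B u v
Complete⇒Adj complete {u} {v} u≢v with edgeJoining u v u≢v
... | e , j with complete e
... | inj₁ e∈R = inj₁ (∈⇒Adj j e∈R)
... | inj₂ e∈B = inj₂ (∈⇒Adj j e∈B)

pairwiseAdjacent⇒clique : ∀ {n k} {E : List (Edge n)} (f : Fin k → Fin n) →
  (∀ i j → i ≢ j → Adj E (f i) (f j)) → HasClique E k
pairwiseAdjacent⇒clique {E = E} f adj = f , injective , adj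
  where
  injective : ∀ {i j} → f i ≡ f j → i ≡ j
  injective {i} {j} fi≡fj with i FP.≟ j
  ... | yes i≡j = i≡j
  ... | no i≢j  = ⊥-elim (Adj-irrefl (subst (Adj E (f i)) (sym fi≡fj) (adj i j i≢j)))

clique-extend : ∀ {n k} {E : List (Edge n)} (f : Fin k → Fin n) →
  (∀ i j → i ≢ j → Adj E (f i) (f j)) →
  (c : Fin n) → (∀ i → Adj E c (f i)) → HasClique E (suc k)
clique-extend {n} {k} {E} f adj c adj-c = pairwiseAdjacent⇒clique g adj-g
  where
  g : Fin (suc k) → Fin n
  g zero    = c
  g (suc i) = f i
  adj-g : ∀ i j → i ≢ j → Adj E (g i) (g j)
  adj-g zero    zero    ne = ⊥-elim (ne refl)
  adj-g zero    (suc j) _  = adj-c j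
  adj-g (suc i) zero    _  = Adj-sym (adj-c i)
  adj-g (suc i) (suc j) ne = adj i j (ne ∘ cong suc)

triangle : ∀ {n} {E : List (Edge n)} {u v w} → Adj E u v → Adj E u w → Adj E v w → HasClique E 3
triangle {n} {E} {u} {v} {w} uv uw vw = clique-extend f adj-f u λ { zero → uv ; (suc zero) → uw }
  where
  f : Fin 2 → Fin n
  f zero       = v
  f (suc zero) = w
  adj-f : ∀ i j → i ≢ j → Adj E (f i) (f j)
  adj-f zero       zero       ne = ⊥-elim (ne refl)
  adj-f zero       (suc zero) _  = vw
  adj-f (suc zero) zero       _  = Adj-sym vw
  adj-f (suc zero) (suc zero) ne = ⊥-elim (ne refl)

HasClique-≤ : ∀ {n m k} {E : List (Edge n)} → k ≤ m → HasClique E m → HasClique E k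
HasClique-≤ k≤m (f , f-injective , adj) =
  (λ i → f (F.inject≤ i k≤m)) ,
  (λ eq → FP.inject≤-injective k≤m k≤m _ _ (f-injective eq)) ,
  (λ i j i≢j → adj _ _ (i≢j ∘ FP.inject≤-injective k≤m k≤m _ _))

covered-by-two⇒≤2 : ∀ {k} (i j : Fin k) → (∀ l → l ≡ i ⊎ l ≡ j) → k ≤ 2
covered-by-two⇒≤2 {k} i j cover = FP.injective⇒≤ injective
  where
  g : Fin k → Fin 2
  g l = [ (λ _ → zero) , (λ _ → suc zero) ] (cover l)
  injective : ∀ {l m} → g l ≡ g m → l ≡ m
  injective {l} {m} _  with cover l | cover m
  injective         _  | inj₁ l≡i | inj₁ m≡i = trans l≡i (sym m≡i)
  injective         _  | inj₂ l≡j | inj₂ m≡j = trans l≡j (sym m≡j)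
  injective         () | inj₁ _   | inj₂ _
  injective         () | inj₂ _   | inj₁ _

module _ {A : Set} where

  length-filter-mono : ∀ {P Q : Pred A 0ℓ} (P? : Decidable P) (Q? : Decidable Q) → (∀ {x} → Q x → P x) →
    ∀ xs → length (filter Q? xs) ≤ length (filter P? xs)
  length-filter-mono P? Q? Q⇒P [] = z≤n
  length-filter-mono P? Q? Q⇒P (x ∷ xs) with P? x | Q? x
  ... | yes _  | yes _  = s≤s (length-filter-mono P? Q? Q⇒P xs)
  ... | yes _  | no _   = ℕP.m≤n⇒m≤1+n (length-filter-mono P? Q? Q⇒P xs)
  ... | no ¬px | yes qx = ⊥-elim (¬px (Q⇒P qx))
  ... | no _   | no _   = length-filter-mono P? Q? Q⇒P xs

  length-filter-< : ∀ {P Q : Pred A 0ℓ} (P? : Decidable P) (Q? : Decidable Q) → (∀ {x} → Q x → P x) →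
    ∀ {y} xs → y ∈ xs → P y → ¬ Q y → length (filter Q? xs) < length (filter P? xs)
  length-filter-< P? Q? Q⇒P (x ∷ xs) (here refl) py ¬qy with P? x | Q? x
  ... | _      | yes qy = ⊥-elim (¬qy qy)
  ... | no ¬py | no _   = ⊥-elim (¬py py)
  ... | yes _  | no _   = s≤s (length-filter-mono P? Q? Q⇒P xs)
  length-filter-< P? Q? Q⇒P (x ∷ xs) (there y∈xs) py ¬qy with P? x | Q? x
  ... | yes _  | yes _  = s≤s (length-filter-< P? Q? Q⇒P xs y∈xs py ¬qy)
  ... | yes _  | no _   = ℕP.m≤n⇒m≤1+n (length-filter-< P? Q? Q⇒P xs y∈xs py ¬qy)
  ... | no ¬px | yes qx = ⊥-elim (¬px (Q⇒P qx))
  ... | no _   | no _   = length-filter-< P? Q? Q⇒P xs y∈xs py ¬qy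

  ∈-take⁻ : ∀ {x : A} k xs → x ∈ take k xs → x ∈ xs
  ∈-take⁻ (suc k) (y ∷ xs) (here x≡y) = here x≡y
  ∈-take⁻ (suc k) (y ∷ xs) (there x∈) = there (∈-take⁻ k xs x∈)

  ∈-take-suc : ∀ {x : A} k xs → x ∈ take k xs → x ∈ take (suc k) xs
  ∈-take-suc (suc k) (y ∷ xs) (here x≡y) = here x≡y
  ∈-take-suc (suc k) (y ∷ xs) (there x∈) = there (∈-take-suc k xs x∈)

  ∈-take-filter : ∀ {P : Pred A 0ℓ} (P? : Decidable P) {x} k xs →
    x ∈ take k xs → P x → x ∈ take k (filter P? xs)
  ∈-take-filter P? (suc k) (y ∷ xs) (here refl) px with P? y
  ... | yes _  = here refl
  ... | no ¬px = ⊥-elim (¬px px)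
  ∈-take-filter P? (suc k) (y ∷ xs) (there x∈) px with P? y
  ... | yes _ = there (∈-take-filter P? k xs x∈ px)
  ... | no _  = ∈-take-suc k _ (∈-take-filter P? k xs x∈ px)

  ∈-take-deduplicate-++ : (_≟_ : DecidableEquality A) → ∀ {x} xs ys k → x ∈ xs → length xs ≤ k →
    x ∈ take k (deduplicate _≟_ (xs ++ ys))
  ∈-take-deduplicate-++ _≟_ (y ∷ xs) ys (suc k) (here refl) _ = here refl
  ∈-take-deduplicate-++ _≟_ {x} (y ∷ xs) ys (suc k) (there x∈) (s≤s len≤k) with x ≟ y
  ... | yes refl = here refl
  ... | no x≢y   =
    there (∈-take-filter (¬? ∘ (y ≟_)) k _ (∈-take-deduplicate-++ _≟_ xs ys k x∈ len≤k) (x≢y ∘ sym))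

-- Uncoloured edges and Bob's moves

edgesAmong : ∀ {n} → List (Fin n × Fin n) → List (Edge n)
edgesAmong [] = []
edgesAmong ((i , j) ∷ ps) with i F.<? j
... | yes i<j = ((i , j) , i<j) ∷ edgesAmong ps
... | no _    = edgesAmong ps

∈-edgesAmong : ∀ {n} {i j : Fin n} ps → (i , j) ∈ ps → (i<j : i F.< j) → ((i , j) , i<j) ∈ edgesAmong ps
∈-edgesAmong ((a , b) ∷ ps) (here refl) i<j with a F.<? b
... | yes a<b  = here (cong ((a , b) ,_) (ℕP.<-irrelevant i<j a<b))
... | no ¬a<b = ⊥-elim (¬a<b i<j)
∈-edgesAmong ((a , b) ∷ ps) (there m) i<j with a F.<? b
... | yes _ = there (∈-edgesAmong ps m i<j)
... | no _  = ∈-edgesAmong ps m i<j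

allEdges : ∀ {n} → List (Edge n)
allEdges {n} = edgesAmong (cartesianProduct (allFin n) (allFin n))

∈-allEdges : ∀ {n} (e : Edge n) → e ∈ allEdges
∈-allEdges ((i , j) , i<j) = ∈-edgesAmong _ (∈-cartesianProduct⁺ (∈-allFin i) (∈-allFin j)) i<j

edgesJoining : ∀ {n} → List (Fin n × Fin n) → List (Edge n)
edgesJoining [] = []
edgesJoining ((u , v) ∷ ps) with u FP.≟ v
... | yes _   = edgesJoining ps
... | no u≢v = proj₁ (edgeJoining u v u≢v) ∷ edgesJoining ps

length-edgesJoining : ∀ {n} (ps : List (Fin n × Fin n)) → length (edgesJoining ps) ≤ length ps
length-edgesJoining [] = z≤n
length-edgesJoining ((u , v) ∷ ps) with u FP.≟ v
... | yes _ = ℕP.m≤n⇒m≤1+n (length-edgesJoining ps)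
... | no _  = s≤s (length-edgesJoining ps)

∈-edgesJoining : ∀ {n} {u v : Fin n} ps → (u , v) ∈ ps → u ≢ v →
  Σ (Edge n) λ e → e ∈ edgesJoining ps × Joins e u v
∈-edgesJoining ((u , v) ∷ ps) (here refl) u≢v with u FP.≟ v
... | yes u≡v  = ⊥-elim (u≢v u≡v)
... | no u≢v' = proj₁ (edgeJoining u v u≢v') , here refl , proj₂ (edgeJoining u v u≢v')
∈-edgesJoining ((a , b) ∷ ps) (there m) u≢v with a FP.≟ b
... | yes _ = ∈-edgesJoining ps m u≢v
... | no _  = let (e , e∈ , j) = ∈-edgesJoining ps m u≢v in e , there e∈ , j

Coloured : ∀ {n} → List (Edge n) → List (Edge n) → Fin n → Fin n → Set
Coloured R B u v = Adj R u v ⊎ Adj B u v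

AllColoured : ∀ {n} → List (Edge n) → List (Edge n) → List (Fin n × Fin n) → Set
AllColoured R B pairs = ∀ {u v} → (u , v) ∈ pairs → u ≢ v → Coloured R B u v

All-Uncoloured⇒¬Adj : ∀ {n} {R B es : List (Edge n)} {u v} →
  All (Uncoloured R B) es → Adj es u v → ¬ Adj R u v
All-Uncoloured⇒¬Adj {u = u} {v} ((e∉R , _) ∷ _) (here j) r = e∉R (Adj⇒∈ {u = u} {v} j r)
All-Uncoloured⇒¬Adj (_ ∷ unc) (there a) r = All-Uncoloured⇒¬Adj unc a r

disjoint-∷ : ∀ {n} {R B : List (Edge n)} {e} → e ∉ B → (∀ {u v} → Adj R u v → ¬ Adj B u v) →
  ∀ {u v} → Adj (e ∷ R) u v → ¬ Adj B u v
disjoint-∷ e∉B _ {u} {v} (here j) b = e∉B (Adj⇒∈ {u = u} {v} j b)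
disjoint-∷ e∉B disjoint (there r) b = disjoint r b

module _ {n : ℕ} where
  open DecMembership (_≟ᴱ_ {n}) using (_∈?_)

  Uncoloured? : ∀ (R B : List (Edge n)) → Decidable (Uncoloured R B)
  Uncoloured? R B e = ¬? (e ∈? R) ×-dec ¬? (e ∈? B)

  uncoloured : List (Edge n) → List (Edge n) → List (Edge n)
  uncoloured R B = filter (Uncoloured? R B) allEdges

  ∈-uncoloured⁻ : ∀ {R B e} → e ∈ uncoloured R B → Uncoloured R B e
  ∈-uncoloured⁻ {R} {B} e∈ = proj₂ (∈-filter⁻ (Uncoloured? R B) {xs = allEdges} e∈)

  ∈-uncoloured⁺ : ∀ {R B e} → Uncoloured R B e → e ∈ uncoloured R B
  ∈-uncoloured⁺ {R} {B} {e} = ∈-filter⁺ (Uncoloured? R B) (∈-allEdges e)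

  ∈-uncoloured⇒¬Complete : ∀ {R B e} → e ∈ uncoloured R B → ¬ Complete R B
  ∈-uncoloured⇒¬Complete e∈ complete with ∈-uncoloured⁻ e∈ | complete _
  ... | e∉R , _   | inj₁ e∈R = e∉R e∈R
  ... | _   , e∉B | inj₂ e∈B = e∉B e∈B

  uncoloured≡[]⇒Complete : ∀ {R B} → uncoloured R B ≡ [] → Complete R B
  uncoloured≡[]⇒Complete {R} {B} eq e with e ∈? R | e ∈? B
  ... | yes e∈R | _       = inj₁ e∈R
  ... | no _    | yes e∈B = inj₂ e∈B
  ... | no e∉R  | no e∉B  = ⊥-elim (AnyP.¬Any[] (subst (e ∈_) eq (∈-uncoloured⁺ (e∉R , e∉B))))

  length-uncoloured-mono : ∀ {R B R' B'} → R ⊆ R' → B ⊆ B' →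
    length (uncoloured R' B') ≤ length (uncoloured R B)
  length-uncoloured-mono R⊆R' B⊆B' = length-filter-mono (Uncoloured? _ _) (Uncoloured? _ _)
    (λ (e∉R' , e∉B') → e∉R' ∘ R⊆R' , e∉B' ∘ B⊆B') allEdges

  length-uncoloured-< : ∀ {R B R' B' e} → R ⊆ R' → B ⊆ B' → Uncoloured R B e → e ∈ R' ⊎ e ∈ B' →
    length (uncoloured R' B') < length (uncoloured R B)
  length-uncoloured-< {e = e} R⊆R' B⊆B' unc coloured = length-filter-< (Uncoloured? _ _) (Uncoloured? _ _)
    (λ (e∉R' , e∉B') → e∉R' ∘ R⊆R' , e∉B' ∘ B⊆B') allEdges (∈-allEdges e) unc
    λ { (e∉R' , e∉B') → [ e∉R' , e∉B' ] coloured }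

  module BobMove (R B : List (Edge n)) (pairs : List (Fin n × Fin n)) (few : length pairs ≤ 3) where
    demanded : List (Edge n)
    demanded = filter (Uncoloured? R B) (edgesJoining pairs)

    candidates : List (Edge n)
    candidates = deduplicate _≟ᴱ_ (demanded ++ uncoloured R B)

    chosen : List (Edge n)
    chosen = take 3 candidates

    chosen-unique : Unique chosen
    chosen-unique = take⁺ 3 (deduplicate-! (demanded ++ uncoloured R B))
      where open UniqueP (_≟ᴱ_ {n}) using (take⁺; deduplicate-!)

    chosen-uncoloured : All (Uncoloured R B) chosen
    chosen-uncoloured = All.tabulate (uncoloured-candidate ∘ ∈-deduplicate⁻ _≟ᴱ_ _ ∘ ∈-take⁻ 3 candidates)
      where
      uncoloured-candidate : ∀ {e} → e ∈ demanded ++ uncoloured R B → Uncoloured R B e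
      uncoloured-candidate e∈ with ∈-++⁻ demanded e∈
      ... | inj₁ e∈demanded   = proj₂ (∈-filter⁻ (Uncoloured? R B) {xs = edgesJoining pairs} e∈demanded)
      ... | inj₂ e∈uncoloured = ∈-uncoloured⁻ e∈uncoloured

    length-chosen : length chosen ≡ 3 ⊎ (length chosen < 3 × Complete R (chosen ++ B))
    length-chosen with 3 ℕ.≤? length candidates
    ... | yes 3≤ = inj₁ (trans (LP.length-take 3 candidates) (ℕP.m≤n⇒m⊓n≡m 3≤))
    ... | no 3≰  = inj₂ (subst (λ es → length es < 3) (sym chosen≡) few-candidates , complete)
      where
      few-candidates : length candidates < 3
      few-candidates = ℕP.≰⇒> 3≰
      chosen≡ : chosen ≡ candidates
      chosen≡ = LP.take-all 3 candidates (ℕP.<⇒≤ few-candidates)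
      complete : Complete R (chosen ++ B)
      complete e with e ∈? R | e ∈? B
      ... | yes e∈R | _       = inj₁ e∈R
      ... | no _    | yes e∈B = inj₂ (∈-++⁺ʳ chosen e∈B)
      ... | no e∉R  | no e∉B  = inj₂ (∈-++⁺ˡ (subst (e ∈_) (sym chosen≡)
                                  (∈-deduplicate⁺ _≟ᴱ_ (∈-++⁺ʳ demanded (∈-uncoloured⁺ (e∉R , e∉B))))))

    B⊆chosen++B : ∀ {u v} → Adj B u v → Adj (chosen ++ B) u v
    B⊆chosen++B = AnyP.++⁺ʳ chosen

    demands-coloured : AllColoured R (chosen ++ B) pairs
    demands-coloured {u} {v} uv∈ u≢v with ∈-edgesJoining pairs uv∈ u≢v
    ... | e , e∈ , j with e ∈? R | e ∈? B
    ...   | yes e∈R | _       = inj₁ (∈⇒Adj j e∈R)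
    ...   | no _    | yes e∈B = inj₂ (∈⇒Adj j (∈-++⁺ʳ chosen e∈B))
    ...   | no e∉R  | no e∉B  = inj₂ (∈⇒Adj j (∈-++⁺ˡ (∈-take-deduplicate-++ _≟ᴱ_ demanded (uncoloured R B) 3
                                  (∈-filter⁺ (Uncoloured? R B) e∈ (e∉R , e∉B)) few-demanded)))
      where
      few-demanded : length demanded ≤ 3
      few-demanded = ℕP.≤-trans (LP.length-filter (Uncoloured? R B) (edgesJoining pairs))
                                (ℕP.≤-trans (length-edgesJoining pairs) few)

    disjoint-after : (∀ {u v} → Adj R u v → ¬ Adj B u v) →
      ∀ {u v} → Adj R u v → ¬ Adj (chosen ++ B) u v
    disjoint-after disjoint r b with AnyP.++⁻ chosen b
    ... | inj₁ b-chosen = All-Uncoloured⇒¬Adj chosen-uncoloured b-chosen r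
    ... | inj₂ b-old    = disjoint r b-old

-- Bob's strategy

module Strategy {n : ℕ} (even : Even n) (h : Fin n) where

  Hub : Fin n → Set
  Hub v = v ≡ h ⊎ v ≡ σ h

  Hub? : ∀ v → Dec (Hub v)
  Hub? v = (v FP.≟ h) ⊎-dec (v FP.≟ σ h)

  hub-h : Hub h
  hub-h = inj₁ refl

  hub-σh : Hub (σ h)
  hub-σh = inj₂ refl

  Hub-σ : ∀ {v} → Hub v → Hub (σ v)
  Hub-σ (inj₁ refl) = inj₂ refl
  Hub-σ (inj₂ refl) = inj₁ (σ-involutive h)

  ¬Hub-σ : ∀ {v} → ¬ Hub v → ¬ Hub (σ v)
  ¬Hub-σ {v} ¬hub hub = ¬hub (subst Hub (σ-involutive v) (Hub-σ hub))

  Hub-pair : ∀ {p q} → Hub p → Hub q → q ≡ p ⊎ q ≡ σ p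
  Hub-pair (inj₁ refl) (inj₁ refl) = inj₁ refl
  Hub-pair (inj₁ refl) (inj₂ refl) = inj₂ refl
  Hub-pair (inj₂ refl) (inj₁ refl) = inj₂ (sym (σ-involutive h))
  Hub-pair (inj₂ refl) (inj₂ refl) = inj₁ refl

  hub-≢ : ∀ {u v} → Hub u → ¬ Hub v → u ≢ v
  hub-≢ hub ¬hub refl = ¬hub hub

  hub-elim : ∀ {P : Fin n → Set} {w} → Hub w → P h → P (σ h) → P w
  hub-elim (inj₁ refl) ph _   = ph
  hub-elim (inj₂ refl) _  pσh = pσh

  σ-≢ : ∀ {i} → σ i ≢ i
  σ-≢ = σ-fixpoint-free even _

  record Mirrored (B : List (Edge n)) (u v : Fin n) : Set where
    field
      generic  : ¬ Hub u → ¬ Hub v → v ≢ σ u → Adj B u (σ v) × Adj B (σ u) v × Adj B (σ u) (σ v)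
      from-hub : Hub u → ¬ Hub v → Adj B h (σ v) × Adj B (σ h) (σ v)
      matching : ¬ Hub u → v ≡ σ u → Adj B h u × Adj B h v
      from-h   : u ≡ h → ¬ Hub v → Adj B v (σ v)

  record Guarded (R B : List (Edge n)) : Set where
    field
      disjoint : ∀ {u v} → Adj R u v → ¬ Adj B u v
      mirrored : ∀ {u v} → Adj R u v → Mirrored B u v

  Invariant : List (Edge n) → List (Edge n) → Set
  Invariant R B = Guarded R B × Adj B h (σ h)

  Mirrored-mono : ∀ {B B' u v} → (∀ {a b} → Adj B a b → Adj B' a b) → Mirrored B u v → Mirrored B' u v
  Mirrored-mono B⊆B' m = record
    { generic  = λ ¬hu ¬hv v≢σu →
        let (b₁ , b₂ , b₃) = generic ¬hu ¬hv v≢σu in B⊆B' b₁ , B⊆B' b₂ , B⊆B' b₃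
    ; from-hub = λ hu ¬hv → let (b₁ , b₂) = from-hub hu ¬hv in B⊆B' b₁ , B⊆B' b₂
    ; matching = λ ¬hu v≡σu → let (b₁ , b₂) = matching ¬hu v≡σu in B⊆B' b₁ , B⊆B' b₂
    ; from-h   = λ u≡h ¬hv → B⊆B' (from-h u≡h ¬hv)
    }
    where open Mirrored m

  Mirrored-generic : ∀ {B u v} → ¬ Hub u → ¬ Hub v → v ≢ σ u →
    Adj B u (σ v) → Adj B (σ u) v → Adj B (σ u) (σ v) → Mirrored B u v
  Mirrored-generic ¬hu ¬hv v≢σu b₁ b₂ b₃ = record
    { generic  = λ _ _ _ → b₁ , b₂ , b₃
    ; from-hub = λ hu → ⊥-elim (¬hu hu)
    ; matching = λ _ v≡σu → ⊥-elim (v≢σu v≡σu)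
    ; from-h   = λ u≡h → ⊥-elim (¬hu (inj₁ u≡h))
    }

  Mirrored-from-hub : ∀ {B u v} → Hub u → ¬ Hub v →
    Adj B h (σ v) → Adj B (σ h) (σ v) → (u ≡ h → Adj B v (σ v)) → Mirrored B u v
  Mirrored-from-hub hu ¬hv b₁ b₂ b₃ = record
    { generic  = λ ¬hu → ⊥-elim (¬hu hu)
    ; from-hub = λ _ _ → b₁ , b₂
    ; matching = λ ¬hu → ⊥-elim (¬hu hu)
    ; from-h   = λ u≡h _ → b₃ u≡h
    }

  Mirrored-to-hub : ∀ {B u v} → ¬ Hub u → Hub v → Mirrored B u v
  Mirrored-to-hub ¬hu hv = record
    { generic  = λ _ ¬hv → ⊥-elim (¬hv hv)
    ; from-hub = λ hu → ⊥-elim (¬hu hu)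
    ; matching = λ _ v≡σu → ⊥-elim (¬Hub-σ ¬hu (subst Hub v≡σu hv))
    ; from-h   = λ u≡h → ⊥-elim (¬hu (inj₁ u≡h))
    }

  Mirrored-within-hub : ∀ {B u v} → Hub u → Hub v → Mirrored B u v
  Mirrored-within-hub hu hv = record
    { generic  = λ ¬hu → ⊥-elim (¬hu hu)
    ; from-hub = λ _ ¬hv → ⊥-elim (¬hv hv)
    ; matching = λ ¬hu → ⊥-elim (¬hu hu)
    ; from-h   = λ _ ¬hv → ⊥-elim (¬hv hv)
    }

  Mirrored-matching : ∀ {B u} → ¬ Hub u → Adj B h u → Adj B h (σ u) → Mirrored B u (σ u)
  Mirrored-matching ¬hu b₁ b₂ = record
    { generic  = λ _ _ σu≢σu → ⊥-elim (σu≢σu refl)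
    ; from-hub = λ hu → ⊥-elim (¬hu hu)
    ; matching = λ _ _ → b₁ , b₂
    ; from-h   = λ u≡h → ⊥-elim (¬hu (inj₁ u≡h))
    }

  Mirrored-matching-sym : ∀ {B u} → ¬ Hub u → Adj B h u → Adj B h (σ u) → Mirrored B (σ u) u
  Mirrored-matching-sym {B} {u} ¬hu b₁ b₂ =
    subst (Mirrored B (σ u)) (σ-involutive u)
      (Mirrored-matching (¬Hub-σ ¬hu) b₂ (subst (Adj B h) (sym (σ-involutive u)) b₁))

  Guarded-∷ : ∀ {R B B' e p q} → Guarded R B → (∀ {a b} → Adj B a b → Adj B' a b) →
    (∀ {u v} → Adj (e ∷ R) u v → ¬ Adj B' u v) →
    Ends e p q → Mirrored B' p q → Mirrored B' q p → Guarded (e ∷ R) B'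
  Guarded-∷ {R} {B} {B'} {e} guarded B⊆B' disjoint' ends-e m-pq m-qp =
    record { disjoint = disjoint' ; mirrored = mirrored' }
    where
    mirrored' : ∀ {u v} → Adj (e ∷ R) u v → Mirrored B' u v
    mirrored' (there r) = Mirrored-mono B⊆B' (Guarded.mirrored guarded r)
    mirrored' (here j) with ends-e j
    ... | inj₁ (refl , refl) = m-pq
    ... | inj₂ (refl , refl) = m-qp

  -- Demanding (h , σ h) where a slot is free is what lets Bob's first reply secure it.
  hub-demand : Fin n → Fin n → Fin n × Fin n
  hub-demand w x with w FP.≟ h
  ... | yes _ = x , σ x
  ... | no _  = h , σ h

  hub-demand-h : ∀ {w} x → w ≡ h → hub-demand w x ≡ (x , σ x)
  hub-demand-h x refl with h FP.≟ h
  ... | yes _   = refl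
  ... | no h≢h = ⊥-elim (h≢h refl)

  hub-demand-σh : ∀ {w} x → w ≡ σ h → hub-demand w x ≡ (h , σ h)
  hub-demand-σh x refl with σ h FP.≟ h
  ... | yes σh≡h = ⊥-elim (σ-≢ σh≡h)
  ... | no _      = refl

  demands : Fin n → Fin n → List (Fin n × Fin n)
  demands p q with q FP.≟ σ p | Hub? p | Hub? q
  ... | yes _ | _     | _     = (h , σ h) ∷ (h , p) ∷ (h , σ p) ∷ []
  ... | no _  | yes _ | _     = (h , σ q) ∷ (σ h , σ q) ∷ hub-demand p q ∷ []
  ... | no _  | no _  | yes _ = (h , σ p) ∷ (σ h , σ p) ∷ hub-demand q p ∷ []
  ... | no _  | no _  | no _  = (p , σ q) ∷ (σ p , q) ∷ (σ p , σ q) ∷ []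

  length-demands : ∀ p q → length (demands p q) ≤ 3
  length-demands p q with q FP.≟ σ p | Hub? p | Hub? q
  ... | yes _ | _     | _     = ℕP.≤-refl
  ... | no _  | yes _ | _     = ℕP.≤-refl
  ... | no _  | no _  | yes _ = ℕP.≤-refl
  ... | no _  | no _  | no _  = ℕP.≤-refl

  module Reply {R B B' : List (Edge n)} (guarded : Guarded R B) {e : Edge n} {p q : Fin n}
               (ends-e : Ends e p q) (¬Bpq : ¬ Adj B p q) where
    open Guarded guarded
    open Mirrored

    blue : ∀ {u v} → ¬ Joins e u v → ¬ Adj R u v → Coloured (e ∷ R) B' u v → Adj B' u v
    blue _      _  (inj₂ b)         = b
    blue ¬Jeuv _  (inj₁ (here j))  = ⊥-elim (¬Jeuv j)
    blue _      ¬r (inj₁ (there r)) = ⊥-elim (¬r r)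

    generic-reply : ¬ Hub p → ¬ Hub q → q ≢ σ p → p ≢ q →
      Coloured (e ∷ R) B' p (σ q) → Coloured (e ∷ R) B' (σ p) q → Coloured (e ∷ R) B' (σ p) (σ q) →
      Mirrored B' p q × Mirrored B' q p
    generic-reply ¬hp ¬hq q≢σp p≢q c₁ c₂ c₃ =
      Mirrored-generic ¬hp ¬hq q≢σp b₁ b₂ b₃ ,
      Mirrored-generic ¬hq ¬hp (≢σ-sym q≢σp) (Adj-sym b₂) (Adj-sym b₁) (Adj-sym b₃)
      where
      ¬Joins-σp : ∀ {v} → ¬ Joins e (σ p) v
      ¬Joins-σp = Ends-¬Joinsˡ {e = e} ends-e σ-≢ (q≢σp ∘ sym)
      b₁ : Adj B' p (σ q)
      b₁ = blue (Ends-¬Joinsʳ {e = e} ends-e (≢σ-sym q≢σp ∘ sym) σ-≢) ¬red c₁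
        where
        ¬red : ¬ Adj R p (σ q)
        ¬red r = ¬Bpq (subst (Adj B p) (σ-involutive q)
          (proj₁ (generic (mirrored r) ¬hp (¬Hub-σ ¬hq) (p≢q ∘ sym ∘ σ-injective))))
      b₂ : Adj B' (σ p) q
      b₂ = blue ¬Joins-σp ¬red c₂
        where
        ¬red : ¬ Adj R (σ p) q
        ¬red r = ¬Bpq (subst (λ a → Adj B a q) (σ-involutive p)
          (proj₁ (proj₂ (generic (mirrored r) (¬Hub-σ ¬hp) ¬hq (≢σ-sym (p≢q ∘ σ-injective))))))
      b₃ : Adj B' (σ p) (σ q)
      b₃ = blue ¬Joins-σp ¬red c₃
        where
        ¬red : ¬ Adj R (σ p) (σ q)
        ¬red r = ¬Bpq (subst₂ (Adj B) (σ-involutive p) (σ-involutive q)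
          (proj₂ (proj₂ (generic (mirrored r) (¬Hub-σ ¬hp) (¬Hub-σ ¬hq) (q≢σp ∘ σ-injective)))))

    hub-reply : Hub p → ¬ Hub q →
      Coloured (e ∷ R) B' h (σ q) → Coloured (e ∷ R) B' (σ h) (σ q) →
      (p ≡ h → Coloured (e ∷ R) B' q (σ q)) →
      Mirrored B' p q × Mirrored B' q p
    hub-reply hp ¬hq c₁ c₂ c₃ = Mirrored-from-hub hp ¬hq b₁ b₂ b₃ , Mirrored-to-hub ¬hq hp
      where
      ¬Joins-σq : ∀ {u} → ¬ Joins e u (σ q)
      ¬Joins-σq = Ends-¬Joinsʳ {e = e} ends-e (hub-≢ hp (¬Hub-σ ¬hq) ∘ sym) σ-≢
      ¬Adj-σq : ∀ {w} → Hub w → ¬ Adj R w (σ q)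
      ¬Adj-σq hw r = let (bh , bσh) = from-hub (mirrored r) hw (¬Hub-σ ¬hq) in
        ¬Bpq (hub-elim {P = λ w → Adj B w q} hp (subst (Adj B h) (σ-involutive q) bh)
                                              (subst (Adj B (σ h)) (σ-involutive q) bσh))
      b₁ : Adj B' h (σ q)
      b₁ = blue ¬Joins-σq (¬Adj-σq hub-h) c₁
      b₂ : Adj B' (σ h) (σ q)
      b₂ = blue ¬Joins-σq (¬Adj-σq hub-σh) c₂
      b₃ : p ≡ h → Adj B' q (σ q)
      b₃ p≡h = blue ¬Joins-σq
        (λ r → ¬Bpq (subst (λ w → Adj B w q) (sym p≡h) (proj₁ (matching (mirrored r) ¬hq refl)))) (c₃ p≡h)

    matching-reply : ¬ Hub p → q ≡ σ p →
      Coloured (e ∷ R) B' h p → Coloured (e ∷ R) B' h (σ p) → Mirrored B' p q × Mirrored B' q p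
    matching-reply ¬hp q≡σp c₁ c₂ =
      subst (Mirrored B' p) (sym q≡σp) (Mirrored-matching ¬hp b₁ b₂) ,
      subst (λ v → Mirrored B' v p) (sym q≡σp) (Mirrored-matching-sym ¬hp b₁ b₂)
      where
      ¬Joins-h : ∀ {v} → ¬ Joins e h v
      ¬Joins-h = Ends-¬Joinsˡ {e = e} ends-e (hub-≢ hub-h ¬hp)
                   (hub-≢ hub-h (subst (¬_ ∘ Hub) (sym q≡σp) (¬Hub-σ ¬hp)))
      ¬Bpσp : ¬ Adj B p (σ p)
      ¬Bpσp = ¬Bpq ∘ subst (Adj B p) (sym q≡σp)
      b₁ : Adj B' h p
      b₁ = blue ¬Joins-h (λ r → ¬Bpσp (from-h (mirrored r) refl ¬hp)) c₁
      b₂ : Adj B' h (σ p)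
      b₂ = blue ¬Joins-h (λ r → ¬Bpσp (subst (λ a → Adj B a (σ p)) (σ-involutive p)
             (Adj-sym (from-h (mirrored r) refl (¬Hub-σ ¬hp))))) c₂

  guarded-after-reply : ∀ {R B B'} e → Guarded R B → e ∉ B → (∀ {u v} → Adj B u v → Adj B' u v) →
    (∀ {u v} → Adj (e ∷ R) u v → ¬ Adj B' u v) → AllColoured (e ∷ R) B' (demands (src e) (tgt e)) →
    Guarded (e ∷ R) B'
  guarded-after-reply {R} {B} {B'} e guarded e∉B B⊆B' disjoint' =
    go (src e) (tgt e) (ends e) (e∉B ∘ Adj⇒∈ (joins-ends e)) (λ eq → FP.<-irrefl eq (proj₂ e))
    where
    finish : ∀ {p q} → Ends e p q → Mirrored B' p q × Mirrored B' q p → Guarded (e ∷ R) B'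
    finish ends-e (m-pq , m-qp) = Guarded-∷ guarded B⊆B' disjoint' ends-e m-pq m-qp
    go : ∀ p q → Ends e p q → ¬ Adj B p q → p ≢ q →
      AllColoured (e ∷ R) B' (demands p q) → Guarded (e ∷ R) B'
    go p q ends-e ¬Bpq p≢q col with q FP.≟ σ p | Hub? p | Hub? q
    ... | yes q≡σp | yes hp | _ =
      finish ends-e (Mirrored-within-hub hp hq , Mirrored-within-hub hq hp)
      where hq = subst Hub (sym q≡σp) (Hub-σ hp)
    ... | yes q≡σp | no ¬hp | _ =
      finish ends-e (matching-reply ¬hp q≡σp (col (there (here refl)) (hub-≢ hub-h ¬hp))
                                       (col (there (there (here refl))) (hub-≢ hub-h (¬Hub-σ ¬hp))))
      where open Reply guarded ends-e ¬Bpq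
    ... | no q≢σp | yes hp | _ =
      finish ends-e (hub-reply hp ¬hq (col (here refl) (hub-≢ hub-h (¬Hub-σ ¬hq)))
                               (col (there (here refl)) (hub-≢ hub-σh (¬Hub-σ ¬hq)))
                               (λ p≡h → col (there (there (here (sym (hub-demand-h q p≡h))))) (σ-≢ ∘ sym)))
      where
      open Reply guarded ends-e ¬Bpq
      ¬hq : ¬ Hub q
      ¬hq hq with Hub-pair hp hq
      ... | inj₁ q≡p  = p≢q (sym q≡p)
      ... | inj₂ q≡σp = q≢σp q≡σp
    ... | no q≢σp | no ¬hp | yes hq =
      finish (Ends-swap {e = e} ends-e) (hub-reply hq ¬hp (col (here refl) (hub-≢ hub-h (¬Hub-σ ¬hp)))
                                     (col (there (here refl)) (hub-≢ hub-σh (¬Hub-σ ¬hp)))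
                                     (λ q≡h → col (there (there (here (sym (hub-demand-h p q≡h))))) (σ-≢ ∘ sym)))
      where open Reply guarded (Ends-swap {e = e} ends-e) (¬Bpq ∘ Adj-sym)
    ... | no q≢σp | no ¬hp | no ¬hq =
      finish ends-e (generic-reply ¬hp ¬hq q≢σp p≢q (col (here refl) (≢σ-sym q≢σp))
                                             (col (there (here refl)) (q≢σp ∘ sym))
                                             (col (there (there (here refl))) (p≢q ∘ σ-injective)))
      where open Reply guarded ends-e ¬Bpq

  module Final {R B : List (Edge n)} (guarded : Guarded R B) (hσh : Adj B h (σ h)) (complete : Complete R B) where
    open Guarded guarded
    open Mirrored

    blue-if-not-red : ∀ {u v} → u ≢ v → ¬ Adj R u v → Adj B u v
    blue-if-not-red u≢v ¬r with Complete⇒Adj complete u≢v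
    ... | inj₁ r = ⊥-elim (¬r r)
    ... | inj₂ b = b

    hub-matching-blue : ∀ {c} → Hub c → Adj B c (σ c)
    hub-matching-blue (inj₁ refl) = hσh
    hub-matching-blue (inj₂ refl) = subst (Adj B (σ h)) (sym (σ-involutive h)) (Adj-sym hσh)

    red-matching⇒¬Hub : ∀ {x} → Adj R x (σ x) → ¬ Hub x
    red-matching⇒¬Hub r hx = disjoint r (hub-matching-blue hx)

    no-red-triangle-on-matching-edge : ∀ {x y} → Adj R x (σ x) → Adj R x y → Adj R (σ x) y → ⊥
    no-red-triangle-on-matching-edge {x} {y} rxσx rxy rσxy with Hub? y
    ... | yes hy =
      let (bh , bσh) = from-hub (mirrored (Adj-sym rxy)) hy ¬hx in
      disjoint (Adj-sym rσxy) (hub-elim {P = λ w → Adj B w (σ x)} hy bh bσh)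
      where ¬hx = red-matching⇒¬Hub rxσx
    ... | no ¬hy = disjoint rσxy (proj₁ (proj₂ (generic (mirrored rxy) (red-matching⇒¬Hub rxσx) ¬hy y≢σx)))
      where
      y≢σx : y ≢ σ x
      y≢σx refl = Adj-irrefl rσxy

    red-matching⇒blue-triangle : ∀ {x} → Adj R x (σ x) → HasClique B 3
    red-matching⇒blue-triangle {x} rxσx with Adj? R (σ h) x
    ... | yes rσhx = triangle hσh (proj₂ (matching (mirrored rxσx) ¬hx refl))
                              (proj₂ (from-hub (mirrored rσhx) hub-σh ¬hx))
      where ¬hx = red-matching⇒¬Hub rxσx
    ... | no ¬rσhx = triangle hσh (proj₁ (matching (mirrored rxσx) ¬hx refl))
                              (blue-if-not-red (hub-≢ hub-σh ¬hx) ¬rσhx)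
      where ¬hx = red-matching⇒¬Hub rxσx

    module _ {k} (f : Fin k → Fin n) (adj : ∀ i j → i ≢ j → Adj R (f i) (f j)) where

      matched-red-clique⇒blue-clique : ∀ i j → f j ≡ σ (f i) → HasClique B (suc k)
      matched-red-clique⇒blue-clique i j fj≡σfi =
        HasClique-≤ (s≤s (covered-by-two⇒≤2 i j cover)) (red-matching⇒blue-triangle rxσx)
        where
        i≢j : i ≢ j
        i≢j refl = σ-≢ (sym fj≡σfi)
        rxσx : Adj R (f i) (σ (f i))
        rxσx = subst (Adj R (f i)) fj≡σfi (adj i j i≢j)
        cover : ∀ l → l ≡ i ⊎ l ≡ j
        cover l with l FP.≟ i | l FP.≟ j
        ... | yes l≡i | _        = inj₁ l≡i
        ... | no _    | yes l≡j  = inj₂ l≡j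
        ... | no l≢i  | no l≢j   = ⊥-elim (no-red-triangle-on-matching-edge rxσx (adj i l (l≢i ∘ sym))
                                     (subst (λ a → Adj R a (f l)) fj≡σfi (adj j l (l≢j ∘ sym))))

      module _ (unmatched : ∀ i j → f j ≢ σ (f i)) where

        σ-image-blue : ∀ i j → i ≢ j → Adj B (σ (f i)) (σ (f j))
        σ-image-blue i j i≢j with Hub? (f i) | Hub? (f j)
        ... | yes hi | yes hj with Hub-pair hi hj
        ...   | inj₁ fj≡fi  = ⊥-elim (Adj-irrefl (subst (Adj R (f i)) fj≡fi (adj i j i≢j)))
        ...   | inj₂ fj≡σfi = ⊥-elim (unmatched i j fj≡σfi)
        σ-image-blue i j i≢j | yes hi | no ¬hj =
          let (bh , bσh) = from-hub (mirrored (adj i j i≢j)) hi ¬hj in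
          hub-elim {P = λ w → Adj B w (σ (f j))} (Hub-σ hi) bh bσh
        σ-image-blue i j i≢j | no ¬hi | yes hj =
          let (bh , bσh) = from-hub (mirrored (adj j i (i≢j ∘ sym))) hj ¬hi in
          Adj-sym (hub-elim {P = λ w → Adj B w (σ (f i))} (Hub-σ hj) bh bσh)
        σ-image-blue i j i≢j | no ¬hi | no ¬hj =
          proj₂ (proj₂ (generic (mirrored (adj i j i≢j)) ¬hi ¬hj (unmatched i j)))

        blue-apex : Σ (Fin n) λ c → ∀ i → Adj B c (σ (f i))
        blue-apex with FP.any? (Hub? ∘ f)
        ... | yes (i , hi) = f i , apex
          where
          apex : ∀ l → Adj B (f i) (σ (f l))
          apex l with i FP.≟ l
          ... | yes refl = hub-matching-blue hi
          ... | no i≢l with Hub? (f l)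
          ...   | yes hl with Hub-pair hi hl
          ...     | inj₁ fl≡fi  = ⊥-elim (Adj-irrefl (subst (Adj R (f i)) fl≡fi (adj i l i≢l)))
          ...     | inj₂ fl≡σfi = ⊥-elim (unmatched i l fl≡σfi)
          apex l | no i≢l | no ¬hl =
            let (bh , bσh) = from-hub (mirrored (adj i l i≢l)) hi ¬hl in
            hub-elim {P = λ w → Adj B w (σ (f l))} hi bh bσh
        ... | no no-hub with FP.any? (λ i → ¬? (Adj? R (f i) (σ (f i))))
        ...   | yes (i , ¬r) = f i , apex
          where
          apex : ∀ l → Adj B (f i) (σ (f l))
          apex l with i FP.≟ l
          ... | yes refl = blue-if-not-red (σ-≢ ∘ sym) ¬r
          ... | no i≢l   =
            proj₁ (generic (mirrored (adj i l i≢l)) (no-hub ∘ (i ,_)) (no-hub ∘ (l ,_)) (unmatched i l))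
        ...   | no all-red = h , λ l → proj₂ (matching (mirrored (red l)) (no-hub ∘ (l ,_)) refl)
          where
          red : ∀ l → Adj R (f l) (σ (f l))
          red l = decidable-stable (Adj? R (f l) (σ (f l))) (λ ¬r → all-red (l , ¬r))

    red-clique⇒larger-blue-clique : ∀ {k} → HasClique R k → HasClique B (suc k)
    red-clique⇒larger-blue-clique (f , _ , adj) with FP.any? (λ i → FP.any? (λ j → f j FP.≟ σ (f i)))
    ... | yes (i , j , fj≡σfi) = matched-red-clique⇒blue-clique f adj i j fj≡σfi
    ... | no matched =
      let (c , adj-c) = blue-apex f adj unmatched in clique-extend (σ ∘ f) (σ-image-blue f adj unmatched) c adj-c
      where
      unmatched : ∀ i j → f j ≢ σ (f i)
      unmatched i j fj≡σfi = matched (i , j , fj≡σfi)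

    bob-score-wins : BobScoreWins R B
    bob-score-wins a b (red-a , _) (_ , b-maximal) = b-maximal (suc a) (red-clique⇒larger-blue-clique red-a)

  hσh-demanded : ∀ p q → q ≡ σ p ⊎ p ≡ σ h → (h , σ h) ∈ demands p q
  hσh-demanded p q matching-or-σh with q FP.≟ σ p | Hub? p | Hub? q | matching-or-σh
  ... | yes _   | _      | _ | _          = here refl
  ... | no q≢σp | _      | _ | inj₁ q≡σp = ⊥-elim (q≢σp q≡σp)
  ... | no _    | yes _  | _ | inj₂ p≡σh = there (there (here (sym (hub-demand-σh q p≡σh))))
  ... | no _    | no ¬hp | _ | inj₂ p≡σh = ⊥-elim (¬hp (inj₂ p≡σh))

  SecuresHubEdge : List (Edge n) → List (Edge n) → Edge n → Set
  SecuresHubEdge R B e = ∀ B' → (∀ {u v} → Adj B u v → Adj B' u v) →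
    AllColoured (e ∷ R) B' (demands (src e) (tgt e)) → Adj B' h (σ h)

  mutual
    aliceToMove : ∀ k R B → length (uncoloured R B) ≤ k → Invariant R B → BobWinsAliceToMove R B
    aliceToMove k R B few (guarded , hσh) with uncoloured R B in eq
    ... | [] = finished complete (Final.bob-score-wins guarded hσh complete)
      where complete = uncoloured≡[]⇒Complete eq
    aliceToMove (suc k) R B few (guarded , hσh) | e₀ ∷ _ =
      move (∈-uncoloured⇒¬Complete (subst (e₀ ∈_) (sym eq) (here refl)))
           (λ e unc → bobToMove k R B e unc (subst (λ l → length l ≤ suc k) (sym eq) few) guarded
                                (λ _ B⊆B' _ → B⊆B' hσh))

    bobToMove : ∀ k R B e → Uncoloured R B e → length (uncoloured R B) ≤ suc k → Guarded R B →
      SecuresHubEdge R B e → BobWinsBobToMove (e ∷ R) B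
    bobToMove k R B e (e∉R , e∉B) few guarded secures with uncoloured (e ∷ R) B in eq
    ... | [] = finished complete (Final.bob-score-wins guarded' (secures B (λ b → b) coloured) complete)
      where
      complete = uncoloured≡[]⇒Complete eq
      coloured : AllColoured (e ∷ R) B (demands (src e) (tgt e))
      coloured _ u≢v = Complete⇒Adj complete u≢v
      guarded' = guarded-after-reply e guarded e∉B (λ b → b)
                   (disjoint-∷ e∉B (Guarded.disjoint guarded)) coloured
    ... | e₀ ∷ _ =
      move (∈-uncoloured⇒¬Complete (subst (e₀ ∈_) (sym eq) (here refl)))
           chosen chosen-unique chosen-uncoloured length-chosen
           (aliceToMove k (e ∷ R) (chosen ++ B) fewer
              (guarded' , secures (chosen ++ B) B⊆chosen++B demands-coloured))
      where
      open BobMove (e ∷ R) B (demands (src e) (tgt e)) (length-demands (src e) (tgt e))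
      guarded' = guarded-after-reply e guarded e∉B B⊆chosen++B
                   (disjoint-after (disjoint-∷ e∉B (Guarded.disjoint guarded))) demands-coloured
      fewer : length (uncoloured (e ∷ R) (chosen ++ B)) ≤ k
      fewer = ℕP.≤-pred (ℕP.≤-trans (s≤s (length-uncoloured-mono (λ e' → e') (∈-++⁺ʳ chosen)))
                (ℕP.≤-trans (length-uncoloured-< there (λ e' → e') (e∉R , e∉B) (inj₁ (here refl))) few))

  bobReplies : ∀ e → Uncoloured [] [] e → ¬ Joins e h (σ h) → (h , σ h) ∈ demands (src e) (tgt e) →
    BobWinsBobToMove (e ∷ []) []
  bobReplies e unc ¬Jehσh hσh∈ =
    bobToMove (length (allEdges {n})) [] [] e unc
      (ℕP.m≤n⇒m≤1+n (LP.length-filter (Uncoloured? {n} [] []) allEdges))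
      (record { disjoint = λ () ; mirrored = λ () }) secures
    where
    secures : SecuresHubEdge [] [] e
    secures _ _ coloured with coloured hσh∈ (σ-≢ ∘ sym)
    ... | inj₁ (here j) = ⊥-elim (¬Jehσh j)
    ... | inj₂ b        = b

away-from : ∀ {m} → Fin (4 + m) → Fin (4 + m)
away-from zero          = suc (suc zero)
away-from (suc zero)    = suc (suc zero)
away-from (suc (suc _)) = zero

away-from-≢ : ∀ {m} (p : Fin (4 + m)) → p ≢ away-from p × p ≢ σ (away-from p)
away-from-≢ zero          = (λ ()) , (λ ())
away-from-≢ (suc zero)    = (λ ()) , (λ ())
away-from-≢ (suc (suc p)) = (λ ()) , (λ ())

-- Bob fixes the hub after Alice's first edge pq: if it is a matching edge, {h , σ h} avoids it;
-- otherwise h = σ p, and the hub demand of pq is the pair (h , σ h).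
bob-wins : ∀ {n} → Even n → 4 ≤ n → BobWinsAliceToMove {n} [] []
bob-wins {n@(suc (suc (suc (suc _))))} even (s≤s (s≤s (s≤s (s≤s _)))) = move ¬complete first
  where
  ¬complete : ¬ Complete {n} [] []
  ¬complete complete with complete ((zero , suc zero) , s≤s z≤n)
  ... | inj₁ ()
  ... | inj₂ ()
  first : ∀ e → Uncoloured [] [] e → BobWinsBobToMove (e ∷ []) []
  first e unc with tgt e FP.≟ σ (src e)
  ... | no q≢σp = bobReplies e unc ¬J (hσh-demanded _ _ (inj₂ (sym (σ-involutive (src e)))))
    where
    open Strategy even (σ (src e))
    ¬J : ¬ Joins e (σ (src e)) (σ (σ (src e)))
    ¬J (inj₁ (p≡σp , _)) = σ-fixpoint-free even (src e) (sym p≡σp)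
    ¬J (inj₂ (_ , q≡σp)) = q≢σp q≡σp
  ... | yes q≡σp = bobReplies e unc ¬J (hσh-demanded _ _ (inj₁ q≡σp))
    where
    open Strategy even (away-from (src e))
    ¬J : ¬ Joins e (away-from (src e)) (σ (away-from (src e)))
    ¬J (inj₁ (p≡h , _))  = proj₁ (away-from-≢ (src e)) p≡h
    ¬J (inj₂ (p≡σh , _)) = proj₂ (away-from-≢ (src e)) p≡σh

theorem4p1 : ∀ (n : ℕ) → 2 ∣ n → 4 ≤ n → BobWinsAliceToMove {n} [] []
theorem4p1 n (divides q refl) 4≤n = bob-wins (even-*2 q) 4≤n
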